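{- Let $\mathcal{A}$ be a real affine hyperplane arrangement with Tits algebra $\Bbbk\Sigma[\mathcal{A}]$ over a field $\Bbbk$, and let $t\in\Bbbk$. An element $w=\sum_F w^F\mathtt{H}_F$ of $\Bbbk\Sigma[\mathcal{A}]$ is characteristic of parameter $t$ if and only if for every flat $X$ of $\mathcal{A}$, \[\sum_{F:\,\mathrm{supp}(F)=X} w^F=\chi(\mathcal{A}^X,t),\] where $\chi(\mathcal{A}^X,t)=\sum_{Y\text{ flat},\,Y\subseteq X}\mu(Y,X)\,t^{\mathrm{rank}(Y)}$ and $\mu$ is the Möbius function of the poset of flats.
   Context: A real affine hyperplane arrangement $\mathcal{A}$ is a finite set of affine hyperplanes in a finite-dimensional real vector space $V$. The hyperplanes split $V$ into a finite collection $\Sigma[\mathcal{A}]$ of convex polyhedra called faces (the closures of the nonempty sets obtained by specifying, for each hyperplane, on which open side of it or on it the points lie). For faces $F,G$, the Tits product $FG$ is the unique face containing $F$ and a small segment starting at a point of the relative interior of $F$ in the direction of a point of the relative interior of $G$. A flat is a nonempty intersection of hyperplanes of $\mathcal{A}$ (the empty intersection being $V$); flats are ordered by inclusion. All minimal flats have a common dimension $d$; the rank of a face $F$ is $\dim F-d$ and the rank of a flat $X$ is $\dim X-d$. The support $\mathrm{supp}(F)$ is the smallest flat containing $F$. The Tits algebra $\Bbbk\Sigma[\mathcal{A}]$ has basis $\{\mathtt{H}_F\}$ with $\mathtt{H}_F\mathtt{H}_G=\mathtt{H}_{FG}$. For $w=\sum_F w^F\mathtt{H}_F$ and a flat $X$,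 set $\chi_X(w)=\sum_{F:\,\mathrm{supp}(F)\subseteq X} w^F$. An element $w$ is characteristic of parameter $t$ if $\chi_X(w)=t^{\mathrm{rank}(X)}$ for every flat $X$. The polynomial $\chi(\mathcal{A}^X,t)$ is the characteristic polynomial of the arrangement under $X$, $\mathcal{A}^X=\{H\cap X: H\in\mathcal{A},\ X\not\subseteq H,\ H\cap X\neq\emptyset\}$. -}

module Defs where

open import Level using (Level; _⊔_; 0ℓ) renaming (suc to lsuc)
open import Algebra.Bundles using (CommutativeRing)
open import Data.Nat using (ℕ; zero; suc; _≤_) renaming (_+_ to _+ℕ_)
open import Data.Fin using (Fin)
open import Data.Fin.Subset using (Subset; inside; outside) renaming (_⊆_ to _⊆ₛ_)
open import Data.Fin.Subset.Properties using (_⊆?_)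
open import Data.Vec using (Vec; lookup; tabulate)
open import Data.Vec.Properties using (≡-dec)
open import Data.Bool using (Bool; true; false; _≟_)
open import Data.List using (List; []; _∷_; length; filter; map; allFin)
open import Data.List.Membership.Propositional using (_∈_)
open import Data.List.Relation.Unary.Unique.Propositional using (Unique)
open import Data.List.Relation.Binary.Sublist.Propositional using () renaming (_⊆_ to _⊑_)
open import Data.Product using (Σ; ∃; _×_; _,_)
open import Data.Sum using (_⊎_)
open import Relation.Nullary using (¬_; Dec; yes; no)
open import Relation.Binary.PropositionalEquality using (_≡_)

IsField : ∀ {c ℓ} → CommutativeRing c ℓ → Set (c ⊔ ℓ)
IsField K = (¬ (0# ≈ 1#)) × (∀ x → ¬ (x ≈ 0#) → ∃ λ y → x * y ≈ 1#)
  where open CommutativeRing K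

record RealNumbers : Set₁ where
  field
    realRing   : CommutativeRing 0ℓ 0ℓ
  open CommutativeRing realRing public
  field
    isField    : IsField realRing
    _<_        : Carrier → Carrier → Set
    <-resp-≈   : ∀ {x x′ y y′} → x ≈ x′ → y ≈ y′ → x < y → x′ < y′
    <-irrefl   : ∀ {x} → ¬ (x < x)
    <-trans    : ∀ {x y z} → x < y → y < z → x < z
    trichotomy : ∀ x y → x < y ⊎ (x ≈ y ⊎ y < x)
    +-mono-<   : ∀ {x y} z → x < y → (x + z) < (y + z)
    *-pos      : ∀ {x y} → 0# < x → 0# < y → 0# < (x * y)
    sup        : (P : Carrier → Set) → (∃ λ x → P x) →
                 (∃ λ b → ∀ x → P x → (x < b ⊎ x ≈ b)) →
                 ∃ λ s → (∀ x → P x → (x < s ⊎ x ≈ s)) ×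
                         (∀ b → (∀ x → P x → (x < b ⊎ x ≈ b)) → (s < b ⊎ s ≈ b))

module RingOps {c ℓ} (K : CommutativeRing c ℓ) where
  open CommutativeRing K

  sumFin : ∀ {m} → (Fin m → Carrier) → Carrier
  sumFin {zero}  f = 0#
  sumFin {suc m} f = f Fin.zero + sumFin (λ i → f (Fin.suc i))

  sumL : ∀ {a} {A : Set a} → List A → (A → Carrier) → Carrier
  sumL []       f = 0#
  sumL (x ∷ xs) f = f x + sumL xs f

  when : ∀ {p} {P : Set p} → Dec P → Carrier → Carrier
  when (yes _) x = x
  when (no _)  x = 0#

  pow : Carrier → ℕ → Carrier
  pow x zero    = 1#
  pow x (suc k) = x * pow x k

data Sign : Set where
  neg zer pos : Sign

isZer : Sign → Bool
isZer zer = true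
isZer neg = false
isZer pos = false

-- zero set of a sign vector: the hyperplanes containing the face
zeroSet : ∀ {n} → Vec Sign n → Subset n
zeroSet σ = tabulate (λ i → isZer (lookup σ i))

_≟ₛ_ : ∀ {n} (S T : Subset n) → Dec (S ≡ T)
_≟ₛ_ = ≡-dec _≟_

module Arrangements (ℝ : RealNumbers) where
  open RealNumbers ℝ
  open RingOps realRing

  record Arrangement (ℓ n : ℕ) : Set where
    field
      a       : Fin n → Fin ℓ → Carrier
      b       : Fin n → Carrier
      nonzero : ∀ i → ¬ (∀ j → a i j ≈ 0#)

    val : Fin n → (Fin ℓ → Carrier) → Carrier
    val i x = sumFin (λ j → a i j * x j) - b i

    SignOf : Sign → Carrier → Set
    SignOf neg r = r < 0#
    SignOf zer r = r ≈ 0#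
    SignOf pos r = 0# < r

    -- faces are identified with their (realised) sign vectors
    IsFace : Vec Sign n → Set
    IsFace σ = ∃ λ (x : Fin ℓ → Carrier) → ∀ i → SignOf (lookup σ i) (val i x)

    InInter : Subset n → (Fin ℓ → Carrier) → Set
    InInter S x = ∀ i → i Data.Fin.Subset.∈ S → val i x ≈ 0#

    -- flats are identified with the set of hyperplanes containing them:
    -- S encodes a flat iff ⋂S is nonempty and S is all hyperplanes containing ⋂S.
    -- Flat inclusion X ⊆ Y corresponds to S_Y ⊆ S_X.
    IsFlat : Subset n → Set
    IsFlat S = (∃ λ x → InInter S x) ×
               (∀ j → (∀ x → InInter S x → val j x ≈ 0#) → j Data.Fin.Subset.∈ S)

    normalsOf : Subset n → List (Fin ℓ → Carrier)
    normalsOf S = map a (filter (λ i → (lookup S i) ≟ inside) (allFin n))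

    LinIndep : List (Fin ℓ → Carrier) → Set
    LinIndep vs = ∀ (c : Fin (length vs) → Carrier) →
                  (∀ j → sumFin (λ k → c k * Data.List.lookup vs k j) ≈ 0#) →
                  ∀ k → c k ≈ 0#

    HasRank : List (Fin ℓ → Carrier) → ℕ → Set
    HasRank vs r = (∃ λ us → us ⊑ vs × LinIndep us × length us ≡ r) ×
                   (∀ us → us ⊑ vs → LinIndep us → length us ≤ r)

    Dim : Subset n → ℕ → Set
    Dim S k = ∃ λ r → HasRank (normalsOf S) r × k +ℕ r ≡ ℓ

    MinimalFlat : Subset n → Set
    MinimalFlat M = IsFlat M × (∀ Y → IsFlat Y → M ⊆ₛ Y → Y ≡ M)

    RankFlat : Subset n → ℕ → Set
    RankFlat X r = ∃ λ dX → ∃ λ d → ∃ λ M →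
                   Dim X dX × MinimalFlat M × Dim M d × r +ℕ d ≡ dX

  record Enumeration {ℓ n} (A : Arrangement ℓ n) : Set where
    open Arrangement A
    field
      faces      : List (Vec Sign n)
      faces-uniq : Unique faces
      faces-spec : ∀ σ → (IsFace σ → σ ∈ faces) × (σ ∈ faces → IsFace σ)
      flats      : List (Subset n)
      flats-uniq : Unique flats
      flats-spec : ∀ S → (IsFlat S → S ∈ flats) × (S ∈ flats → IsFlat S)

module TitsNotions (ℝ : RealNumbers) {ℓ n : ℕ}
                   (A : Arrangements.Arrangement ℝ ℓ n)
                   (E : Arrangements.Enumeration ℝ A)
                   {c ℓ′} (K : CommutativeRing c ℓ′) where
  open Arrangements ℝ using (module Arrangement; module Enumeration)
  open Arrangement A public using (IsFace; IsFlat; RankFlat)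
  open Enumeration E
  open CommutativeRing K
  open RingOps K

  -- an element w = Σ_F w^F H_F of kΣ[A]: coefficients w^σ for each face σ
  -- (only the values on faces in the enumeration are ever used)
  TitsElem : Set c
  TitsElem = Vec Sign n → Carrier

  -- χ_X(w) = Σ_{F : supp F ⊆ X} w^F      (supp F ⊆ X  ⇔  S_X ⊆ zeroSet F)
  χ : TitsElem → Subset n → Carrier
  χ w X = sumL faces (λ σ → when (X ⊆? zeroSet σ) (w σ))

  χ= : TitsElem → Subset n → Carrier
  χ= w X = sumL faces (λ σ → when (zeroSet σ ≟ₛ X) (w σ))

  IsCharacteristic : TitsElem → Carrier → Set ℓ′
  IsCharacteristic w t = ∀ X → IsFlat X → ∀ r → RankFlat X r → χ w X ≈ pow t r

  -- μ is the Möbius function of the poset of flats: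
  -- for flats Y ⊆ X, Σ_{Z flat, Y ⊆ Z ⊆ X} μ(Y,Z) = δ(Y,X)
  -- (geometric Y ⊆ Z ⊆ X  ⇔  S_X ⊆ S_Z ⊆ S_Y)
  IsMobius : (Subset n → Subset n → Carrier) → Set ℓ′
  IsMobius μ = ∀ Y X → IsFlat Y → IsFlat X → X ⊆ₛ Y →
    sumL flats (λ Z → when (X ⊆? Z) (when (Z ⊆? Y) (μ Y Z)))
      ≈ when (Y ≟ₛ X) 1#

  charPoly : (Subset n → Subset n → Carrier) → (Subset n → ℕ) → Subset n → Carrier → Carrier
  charPoly μ rk X t = sumL flats (λ Y → when (X ⊆? Y) (μ Y X * pow t (rk Y)))

{-# OPTIONS --safe #-}

-- Grouping the faces by support gives χ_X(w) = Σ_{Y ⊆ X} Σ_{supp F = Y} w^F, the outer sum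
-- running over the flats Y ⊆ X (a flat is encoded by its set of hyperplanes, so this is sum⊇).
-- By the defining identity of μ, summing χ(A^Y, t) over the flats Y ⊆ X gives t^{rank X}, and
-- f ↦ (X ↦ Σ_{Y ⊆ X} f Y) is injective on functions on flats, being unitriangular. Hence the
-- two conditions on w are equivalent.
--
-- This needs rank X to be well defined, i.e. all minimal flats to have the same dimension. If M
-- is minimal, every hyperplane normal lies in the span of the normals of M: otherwise, solving a
-- linear system, that hyperplane meets M and cuts out a strictly smaller flat. By Steinitz
-- exchange the normals of a minimal flat therefore have maximal rank.

module Submission where

open import Defs
open import Level using (Level; _⊔_; 0ℓ)
open import Algebra.Bundles using (CommutativeRing)
import Algebra.Properties.CommutativeSemigroup
open import Data.Nat using (ℕ; zero; suc; _≤_; z≤n; s≤s)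
open import Data.Nat.Properties using (≤-trans; ≤-antisym; +-cancelʳ-≡; _≤?_)
open import Data.Fin using (Fin; zero; suc; punchIn; punchOut)
open import Data.Fin.Properties using (_≟_; any?; punchIn-punchOut; ∀-cons; ¬∀⟶∃¬)
open import Data.Fin.Subset using (Subset; _∈_; _∉_; _⊂_; _⊃_) renaming (_⊆_ to _⊆ₛ_)
open import Data.Fin.Subset.Properties using (_⊆?_; _∈?_; ⊆-refl; ⊆-antisym; ⊆-trans; drop-there)
open import Data.Fin.Subset.Induction using (⊃-wellFounded; Acc; acc)
open import Data.Vec using (Vec)
import Data.Vec as Vec
open import Data.Vec.Properties using ([]=⇒lookup; lookup⇒[]=; lookup∘tabulate)
open import Data.Vec.Functional using (Vector; insertAt)
import Data.Vec.Functional as V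
open import Data.Bool using (true)
open import Data.List using (List; []; _∷_)
import Data.List as List
import Data.List.Membership.Propositional as List
open import Data.List.Membership.Propositional.Properties using (∈-map⁺; ∈-map⁻; ∈-filter⁺; ∈-allFin; ∈-lookup)
open import Data.List.Relation.Unary.All as All using ()
open import Data.List.Relation.Unary.Any using (here; there)
open import Data.List.Relation.Unary.AllPairs using (_∷_)
open import Data.List.Relation.Unary.Unique.Propositional using (Unique)
open import Data.List.Relation.Binary.Sublist.Propositional using ([]; _∷_; _∷ʳ_) renaming (_⊆_ to _⊑_)
import Data.List.Relation.Binary.Sublist.Propositional as Sublist
open import Data.Product using (∃; _×_; _,_; proj₁; proj₂)
open import Data.Sum using (inj₁; inj₂)
open import Effect.Monad using (RawMonad)
open import Function using (_∘_; _⇔_; mk⇔; Equivalence)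
open import Relation.Binary using (Decidable)
open import Relation.Binary.PropositionalEquality as ≡ using (_≡_; _≢_)
open import Relation.Nullary using (¬_; Dec; does; yes; no; ¬?)
open import Relation.Nullary.Decidable using (decidable-stable; ¬¬-excluded-middle; _→-dec_)
open import Relation.Nullary.Negation using (¬¬-Monad; contradiction)

module _ {a} {A : Set a} where

  insertAt-self : ∀ {n} (x : Vector A n) k s → insertAt x k s k ≡ s
  insertAt-self x       zero    s = ≡.refl
  insertAt-self {suc n} x (suc k) s = insertAt-self (x ∘ suc) k s

  insertAt-punchIn : ∀ {n} (x : Vector A n) k s j → insertAt x k s (punchIn k j) ≡ x j
  insertAt-punchIn x       zero    s j       = ≡.refl
  insertAt-punchIn {suc n} x (suc k) s zero    = ≡.refl
  insertAt-punchIn {suc n} x (suc k) s (suc j) = insertAt-punchIn (x ∘ suc) k s j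

module _ {p : Level} where
  open RawMonad (¬¬-Monad {a = p})

  ¬¬-∀ : ∀ {n} {P : Fin n → Set p} → (∀ i → ¬ ¬ P i) → ¬ ¬ (∀ i → P i)
  ¬¬-∀ {zero}  ¬¬P = pure (λ ())
  ¬¬-∀ {suc n} ¬¬P = do
    P₀ ← ¬¬P zero
    Pₛ ← ¬¬-∀ (¬¬P ∘ suc)
    pure (∀-cons P₀ Pₛ)

  comprehension : ∀ {n} {Q : Fin n → Set p} → (∀ i → Dec (Q i)) → ∃ λ (Y : Subset n) → ∀ i → i ∈ Y ⇔ Q i
  comprehension {zero}  Q? = Vec.[] , λ ()
  comprehension {suc n} {Q} Q? = does (Q? zero) Vec.∷ Y , ∀-cons (here⇔ (Q? zero)) there⇔
    where
    Y = proj₁ (comprehension (Q? ∘ suc))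
    Y⇔Q = proj₂ (comprehension (Q? ∘ suc))
    here⇔ : (Q₀? : Dec (Q zero)) → zero ∈ does Q₀? Vec.∷ Y ⇔ Q zero
    here⇔ (yes Q₀) = mk⇔ (λ _ → Q₀) (λ _ → Vec.here)
    here⇔ (no ¬Q₀) = mk⇔ (λ ()) (λ Q₀ → contradiction Q₀ ¬Q₀)
    there⇔ : ∀ i → suc i ∈ does (Q? zero) Vec.∷ Y ⇔ Q (suc i)
    there⇔ i = mk⇔ (Equivalence.to (Y⇔Q i) ∘ drop-there) (Vec.there ∘ Equivalence.from (Y⇔Q i))

  ¬¬-comprehension : ∀ {n} (Q : Fin n → Set p) → ¬ ¬ ∃ λ (Y : Subset n) → ∀ i → i ∈ Y ⇔ Q i
  ¬¬-comprehension Q = do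
    Q? ← ¬¬-∀ (λ i → ¬¬-excluded-middle)
    pure (comprehension Q?)

⊆∧≢⇒⊂ : ∀ {n} {p q : Subset n} → p ⊆ₛ q → p ≢ q → p ⊂ q
⊆∧≢⇒⊂ {n} {p} {q} p⊆q p≢q = p⊆q , i , i∈q , i∉p
  where
  witness = ¬∀⟶∃¬ n _ (λ i → i ∈? q →-dec i ∈? p) (λ q⊆p → p≢q (⊆-antisym p⊆q (q⊆p _)))
  i = proj₁ witness
  i∈q : i ∈ q
  i∈q = decidable-stable (i ∈? q) (λ i∉q → proj₂ witness (λ i∈q → contradiction i∈q i∉q))
  i∉p : i ∉ p
  i∉p i∈p = proj₂ witness (λ _ → i∈p)

module Sums {ℓ₁ ℓ₂} (R : CommutativeRing ℓ₁ ℓ₂) where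
  open CommutativeRing R hiding (zero)
  open RingOps R
  open import Algebra.Properties.Semiring.Sum semiring using (sum)
  open import Algebra.Properties.Ring ring using (+-cancelˡ; +-cancelʳ)
  open import Algebra.Properties.CommutativeSemigroup +-commutativeSemigroup using (interchange)
  open import Relation.Binary.Reasoning.Setoid setoid

  sumFin≡sum : ∀ {m} (f : Fin m → Carrier) → sumFin f ≡ sum f
  sumFin≡sum {zero}  f = ≡.refl
  sumFin≡sum {suc m} f = ≡.cong (f zero +_) (sumFin≡sum (f ∘ suc))

  private variable
    a b : Level
    A : Set a
    B : Set b

  sumL-cong : ∀ L {f g : A → Carrier} → (∀ {x} → x List.∈ L → f x ≈ g x) → sumL L f ≈ sumL L g
  sumL-cong []      f≈g = refl
  sumL-cong (x ∷ L) f≈g = +-cong (f≈g (here ≡.refl)) (sumL-cong L (f≈g ∘ there))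

  sumL-zero : ∀ L {f : A → Carrier} → (∀ {x} → x List.∈ L → f x ≈ 0#) → sumL L f ≈ 0#
  sumL-zero []      f≈0 = refl
  sumL-zero (x ∷ L) f≈0 = trans (+-cong (f≈0 (here ≡.refl)) (sumL-zero L (f≈0 ∘ there))) (+-identityˡ 0#)

  sumL-+ : ∀ L (f g : A → Carrier) → sumL L (λ x → f x + g x) ≈ sumL L f + sumL L g
  sumL-+ []      f g = sym (+-identityˡ 0#)
  sumL-+ (x ∷ L) f g = trans (+-congˡ (sumL-+ L f g)) (interchange (f x) (g x) _ _)

  sumL-*ʳ : ∀ L (f : A → Carrier) k → sumL L (λ x → f x * k) ≈ sumL L f * k
  sumL-*ʳ []      f k = sym (zeroˡ k)
  sumL-*ʳ (x ∷ L) f k = trans (+-congˡ (sumL-*ʳ L f k)) (sym (distribʳ k (f x) _))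

  sumL-comm : ∀ L (M : List B) (f : A → B → Carrier) →
              sumL L (λ x → sumL M (f x)) ≈ sumL M (λ y → sumL L (λ x → f x y))
  sumL-comm []      M f = sym (sumL-zero M (λ _ → refl))
  sumL-comm (x ∷ L) M f = trans (+-congˡ (sumL-comm L M f)) (sym (sumL-+ M (f x) _))

  sumL-single : ∀ {L} → Unique L → ∀ {z} → z List.∈ L → (g : A → Carrier) →
                (∀ {y} → y List.∈ L → y ≢ z → g y ≈ 0#) → sumL L g ≈ g z
  sumL-single {L = x ∷ L} (x∉L ∷ _) (here ≡.refl) g g≈0 = begin
    g x + sumL L g   ≈⟨ +-congˡ (sumL-zero L (λ y∈L → g≈0 (there y∈L) (≡.≢-sym (All.lookup x∉L y∈L)))) ⟩
    g x + 0#         ≈⟨ +-identityʳ (g x) ⟩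
    g x              ∎
  sumL-single {L = x ∷ L} (x∉L ∷ L!) {z} (there z∈L) g g≈0 = begin
    g x + sumL L g   ≈⟨ +-congʳ (g≈0 (here ≡.refl) (All.lookup x∉L z∈L)) ⟩
    0# + sumL L g    ≈⟨ +-identityˡ _ ⟩
    sumL L g         ≈⟨ sumL-single L! z∈L g (g≈0 ∘ there) ⟩
    g z              ∎

  sumL-agree-off : ∀ {L} → Unique L → ∀ {z} → z List.∈ L → (f g : A → Carrier) →
                   (∀ {y} → y List.∈ L → y ≢ z → f y ≈ g y) → sumL L f ≈ sumL L g → f z ≈ g z
  sumL-agree-off {L = x ∷ L} (x∉L ∷ _) (here ≡.refl) f g f≈g Σf≈Σg =
    +-cancelʳ (sumL L f) (f x) (g x) (trans Σf≈Σg (+-congˡ (sym (sumL-cong L tail≈))))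
    where
    tail≈ : ∀ {y} → y List.∈ L → f y ≈ g y
    tail≈ y∈L = f≈g (there y∈L) (≡.≢-sym (All.lookup x∉L y∈L))
  sumL-agree-off {L = x ∷ L} (x∉L ∷ L!) (there z∈L) f g f≈g Σf≈Σg =
    sumL-agree-off L! z∈L f g (f≈g ∘ there)
      (+-cancelˡ (f x) _ _ (trans Σf≈Σg (+-congʳ (sym (f≈g (here ≡.refl) (All.lookup x∉L z∈L))))))

  when-yes : ∀ {p} {P : Set p} (P? : Dec P) {x} → P → when P? x ≈ x
  when-yes (yes _) _  = refl
  when-yes (no ¬P) pf = contradiction pf ¬P

  when-no : ∀ {p} {P : Set p} (P? : Dec P) {x} → ¬ P → when P? x ≈ 0#
  when-no (yes pf) ¬P = contradiction pf ¬P
  when-no (no _)   _  = refl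

  when-zero : ∀ {p} {P : Set p} (P? : Dec P) → when P? 0# ≈ 0#
  when-zero (yes _) = refl
  when-zero (no _)  = refl

  when-cong : ∀ {p} {P : Set p} (P? : Dec P) {x y} → x ≈ y → when P? x ≈ when P? y
  when-cong (yes _) x≈y = x≈y
  when-cong (no _)  _   = refl

  when-*ʳ : ∀ {p} {P : Set p} (P? : Dec P) x k → when P? (x * k) ≈ when P? x * k
  when-*ʳ (yes _) x k = refl
  when-*ʳ (no _)  x k = sym (zeroˡ k)

  when-sumL : ∀ {p} {P : Set p} (P? : Dec P) L (f : A → Carrier) →
              when P? (sumL L f) ≈ sumL L (λ x → when P? (f x))
  when-sumL (yes _) L f = refl
  when-sumL (no _)  L f = sym (sumL-zero L (λ _ → refl))

module LinearAlgebra {ℓ₁ ℓ₂} (K : CommutativeRing ℓ₁ ℓ₂) (isField : IsField K)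
                     (_≈?_ : Decidable (CommutativeRing._≈_ K)) where
  open CommutativeRing K hiding (zero)
  open import Algebra.Properties.Ring ring using (-‿distribˡ-*; -‿distribʳ-*; +-inverseˡ-unique; +-cancelʳ; //-rightDividesˡ)
  open import Algebra.Properties.Semiring.Sum semiring
    using (sum; sum-cong-≋; sum-cong-≗; sum-replicate-zero; ∑-distrib-+; ∑-comm; sum-remove; *-distribˡ-sum; *-distribʳ-sum)
  open import Relation.Binary.Reasoning.Setoid setoid

  Matrix : ℕ → ℕ → Set ℓ₁
  Matrix p m = Fin p → Fin m → Carrier

  infix 7 _·_ _⊙_

  _·_ : ∀ {m} → Vector Carrier m → Vector Carrier m → Carrier
  u · x = sum (λ j → u j * x j)

  _⊙_ : ∀ {p m} → Vector Carrier p → Matrix p m → Vector Carrier m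
  (c ⊙ R) j = c · (λ k → R k j)

  Independent : ∀ {p m} → Matrix p m → Set (ℓ₁ ⊔ ℓ₂)
  Independent R = ∀ c → (∀ j → (c ⊙ R) j ≈ 0#) → ∀ k → c k ≈ 0#

  InRowSpace : ∀ {p m} → Matrix p m → Vector Carrier m → Set (ℓ₁ ⊔ ℓ₂)
  InRowSpace R v = ∃ λ c → ∀ j → v j ≈ (c ⊙ R) j

  Solvable : ∀ {p m} → Matrix p m → Set (ℓ₁ ⊔ ℓ₂)
  Solvable {p} R = ∀ (y : Vector Carrier p) → ∃ λ x → ∀ k → R k · x ≈ y k

  sum-cong : ∀ {m} {f g : Vector Carrier m} → (∀ j → f j ≈ g j) → sum f ≈ sum g
  sum-cong {m} {f} {g} = sum-cong-≋ {m} {f} {g}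

  sum-zero : ∀ {m} {f : Vector Carrier m} → (∀ j → f j ≈ 0#) → sum f ≈ 0#
  sum-zero {m} f≈0 = trans (sum-cong f≈0) (sum-replicate-zero m)

  ·-zeroˡ : ∀ {m} {u : Vector Carrier m} x → (∀ j → u j ≈ 0#) → u · x ≈ 0#
  ·-zeroˡ x u≈0 = sum-zero (λ j → trans (*-congʳ (u≈0 j)) (zeroˡ (x j)))

  ·-*ˡ : ∀ {m} a (u x : Vector Carrier m) → a * (u · x) ≈ (λ j → a * u j) · x
  ·-*ˡ a u x = trans (*-distribˡ-sum a (λ j → u j * x j)) (sum-cong (λ j → sym (*-assoc a (u j) (x j))))

  ⊙-· : ∀ {p m} (c : Vector Carrier p) (R : Matrix p m) x → (c ⊙ R) · x ≈ c · (λ k → R k · x)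
  ⊙-· c R x = begin
    sum (λ j → sum (λ k → c k * R k j) * x j)   ≈⟨ sum-cong (λ j → *-distribʳ-sum (x j) (λ k → c k * R k j)) ⟩
    sum (λ j → sum (λ k → c k * R k j * x j))   ≈⟨ ∑-comm (λ j k → c k * R k j * x j) ⟩
    sum (λ k → sum (λ j → c k * R k j * x j))   ≈⟨ sum-cong (λ k → sym (·-*ˡ (c k) (R k) x)) ⟩
    sum (λ k → c k * (R k · x))                 ∎

  rowSpace-⊥ : ∀ {p m} {R : Matrix p m} {v} y → InRowSpace R v → (∀ k → R k · y ≈ 0#) → v · y ≈ 0#
  rowSpace-⊥ {R = R} {v} y (c , v≈cR) Ry≈0 = begin
    v · y                       ≈⟨ sum-cong (λ j → *-congʳ (v≈cR j)) ⟩
    (c ⊙ R) · y                 ≈⟨ ⊙-· c R y ⟩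
    c · (λ k → R k · y)         ≈⟨ sum-zero (λ k → trans (*-congˡ (Ry≈0 k)) (zeroʳ (c k))) ⟩
    0#                          ∎

  0≉1 : ¬ 0# ≈ 1#
  0≉1 = proj₁ isField

  inverse : ∀ x → ¬ x ≈ 0# → ∃ λ y → x * y ≈ 1#
  inverse = proj₂ isField

  ⊙-zero : ∀ {p m} (R : Matrix p m) → ∀ j → ((λ _ → 0#) ⊙ R) j ≈ 0#
  ⊙-zero R j = sum-zero (λ k → zeroˡ (R k j))

  inRowSpace-head : ∀ {p m} (v : Vector Carrier m) (R : Matrix p m) → InRowSpace (v V.∷ R) v
  inRowSpace-head v R = 1# V.∷ (λ _ → 0#) , λ j → sym (begin
    1# * v j + ((λ _ → 0#) ⊙ R) j   ≈⟨ +-cong (*-identityˡ (v j)) (⊙-zero R j) ⟩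
    v j + 0#                        ≈⟨ +-identityʳ (v j) ⟩
    v j                             ∎)

  inRowSpace-tail : ∀ {p m} (v : Vector Carrier m) {R : Matrix p m} {u} → InRowSpace R u → InRowSpace (v V.∷ R) u
  inRowSpace-tail v {R} (c , u≈cR) = 0# V.∷ c , λ j → trans (u≈cR j) (sym (begin
    0# * v j + (c ⊙ R) j   ≈⟨ +-congʳ (zeroˡ (v j)) ⟩
    0# + (c ⊙ R) j         ≈⟨ +-identityˡ _ ⟩
    (c ⊙ R) j              ∎))

  independent-∷ : ∀ {p m} {R : Matrix p m} {v} → Independent R → ¬ InRowSpace R v → Independent (v V.∷ R)
  independent-∷ {R = R} {v} ind v∉R d d⊙≈0 with d zero ≈? 0#
  ... | yes d₀≈0 = λ { zero → d₀≈0 ; (suc k) → ind (d ∘ suc) tail≈0 k }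
    where
    tail≈0 : ∀ j → ((d ∘ suc) ⊙ R) j ≈ 0#
    tail≈0 j = begin
      ((d ∘ suc) ⊙ R) j               ≈⟨ +-identityˡ _ ⟨
      0# + ((d ∘ suc) ⊙ R) j          ≈⟨ +-congʳ (trans (*-congʳ d₀≈0) (zeroˡ (v j))) ⟨
      d zero * v j + ((d ∘ suc) ⊙ R) j ≈⟨ d⊙≈0 j ⟩
      0#                              ∎
  ... | no d₀≉0 = contradiction (c , v≈cR) v∉R
    where
    ι = proj₁ (inverse (d zero) d₀≉0)
    c : Vector Carrier _
    c k = - ι * d (suc k)
    v≈cR : ∀ j → v j ≈ (c ⊙ R) j
    v≈cR j = begin
      v j                              ≈⟨ *-identityˡ (v j) ⟨
      1# * v j                         ≈⟨ *-congʳ (trans (*-comm _ _) (proj₂ (inverse (d zero) d₀≉0))) ⟨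
      ι * d zero * v j                 ≈⟨ *-assoc ι (d zero) (v j) ⟩
      ι * (d zero * v j)               ≈⟨ *-congˡ (+-inverseˡ-unique _ _ (d⊙≈0 j)) ⟩
      ι * - ((d ∘ suc) ⊙ R) j          ≈⟨ -‿distribʳ-* ι _ ⟨
      - (ι * ((d ∘ suc) ⊙ R) j)        ≈⟨ -‿distribˡ-* ι _ ⟩
      - ι * ((d ∘ suc) ⊙ R) j          ≈⟨ ·-*ˡ (- ι) (d ∘ suc) (λ k → R k j) ⟩
      (c ⊙ R) j                        ∎

  module _ {m : ℕ} where
    open RawMonad (¬¬-Monad {a = ℓ₁ ⊔ ℓ₂})

    Basis : List (Vector Carrier m) → List (Vector Carrier m) → Set (ℓ₁ ⊔ ℓ₂)
    Basis gs N = gs ⊑ N × Independent (List.lookup gs) × (∀ {v} → v List.∈ N → InRowSpace (List.lookup gs) v)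

    ¬¬-basis : ∀ N → ¬ ¬ ∃ λ gs → Basis gs N
    ¬¬-basis [] = pure ([] , [] , (λ _ _ ()) , λ ())
    ¬¬-basis (v ∷ N) = do
      gs , gs⊆N , ind , span ← ¬¬-basis N
      v∈? ← ¬¬-excluded-middle {A = InRowSpace (List.lookup gs) v}
      pure (extend gs gs⊆N ind span v∈?)
      where
      extend : ∀ gs → gs ⊑ N → Independent (List.lookup gs) → (∀ {u} → u List.∈ N → InRowSpace (List.lookup gs) u) →
               Dec (InRowSpace (List.lookup gs) v) → ∃ λ gs′ → Basis gs′ (v ∷ N)
      extend gs gs⊆N ind span (yes v∈) = gs , v ∷ʳ gs⊆N , ind , λ { (here ≡.refl) → v∈ ; (there u∈) → span u∈ }
      extend gs gs⊆N ind span (no v∉) = v ∷ gs , ≡.refl ∷ gs⊆N , independent-∷ ind v∉ ,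
        λ { (here ≡.refl) → inRowSpace-head v (List.lookup gs) ; (there u∈) → inRowSpace-tail v (span u∈) }

  -- One step of Gaussian elimination: clear column k using row 0, then delete that column.
  module Pivot {p m} (R : Matrix (suc p) (suc m)) (k : Fin (suc m)) (R₀ₖ≉0 : ¬ R zero k ≈ 0#) where

    ι : Carrier
    ι = proj₁ (inverse (R zero k) R₀ₖ≉0)

    pivot-cancel : ∀ z → R zero k * (z * ι) ≈ z
    pivot-cancel z = begin
      R zero k * (z * ι)   ≈⟨ *-congˡ (*-comm z ι) ⟩
      R zero k * (ι * z)   ≈⟨ *-assoc (R zero k) ι z ⟨
      R zero k * ι * z     ≈⟨ *-congʳ (proj₂ (inverse (R zero k) R₀ₖ≉0)) ⟩
      1# * z               ≈⟨ *-identityˡ z ⟩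
      z                    ∎

    μ : Vector Carrier p
    μ i = - (R (suc i) k * ι)

    cleared : Matrix p (suc m)
    cleared i j = R (suc i) j + μ i * R zero j

    reduced : Matrix p m
    reduced i j = cleared i (punchIn k j)

    cleared-pivot : ∀ i → cleared i k ≈ 0#
    cleared-pivot i = begin
      R (suc i) k + μ i * R zero k             ≈⟨ +-congˡ (-‿distribˡ-* _ (R zero k)) ⟨
      R (suc i) k + - (R (suc i) k * ι * R zero k) ≈⟨ +-congˡ (-‿cong (trans (*-comm _ _) (pivot-cancel _))) ⟩
      R (suc i) k + - R (suc i) k              ≈⟨ -‿inverseʳ _ ⟩
      0#                                       ∎

    ⊙-cleared : ∀ c j → (((c · μ) V.∷ c) ⊙ R) j ≈ (c ⊙ cleared) j
    ⊙-cleared c j = begin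
      (c · μ) * R zero j + sum (λ i → c i * R (suc i) j)          ≈⟨ +-comm _ _ ⟩
      sum (λ i → c i * R (suc i) j) + (c · μ) * R zero j          ≈⟨ +-congˡ (*-distribʳ-sum (R zero j) (λ i → c i * μ i)) ⟩
      sum (λ i → c i * R (suc i) j) + sum (λ i → c i * μ i * R zero j)
                                    ≈⟨ +-congˡ (sum-cong (λ i → *-assoc (c i) (μ i) (R zero j))) ⟩
      sum (λ i → c i * R (suc i) j) + sum (λ i → c i * (μ i * R zero j))
                                    ≈⟨ ∑-distrib-+ (λ i → c i * R (suc i) j) (λ i → c i * (μ i * R zero j)) ⟨
      sum (λ i → c i * R (suc i) j + c i * (μ i * R zero j))      ≈⟨ sum-cong (λ i → distribˡ (c i) (R (suc i) j) (μ i * R zero j)) ⟨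
      (c ⊙ cleared) j                                             ∎

    reduced-independent : Independent R → Independent reduced
    reduced-independent ind c c⊙reduced≈0 i = ind ((c · μ) V.∷ c) (λ j → trans (⊙-cleared c j) (cleared≈0 j)) (suc i)
      where
      cleared≈0 : ∀ j → (c ⊙ cleared) j ≈ 0#
      cleared≈0 j with k ≟ j
      ... | yes ≡.refl = sum-zero (λ i → trans (*-congˡ (cleared-pivot i)) (zeroʳ (c i)))
      ... | no k≢j = ≡.subst (λ j → (c ⊙ cleared) j ≈ 0#) (punchIn-punchOut k≢j) (c⊙reduced≈0 (punchOut k≢j))

    cleared-· : ∀ i x → cleared i · x ≈ R (suc i) · x + μ i * (R zero · x)
    cleared-· i x = begin
      sum (λ j → (R (suc i) j + μ i * R zero j) * x j)           ≈⟨ sum-cong (λ j → distribʳ (x j) (R (suc i) j) (μ i * R zero j)) ⟩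
      sum (λ j → R (suc i) j * x j + μ i * R zero j * x j)        ≈⟨ ∑-distrib-+ (λ j → R (suc i) j * x j) (λ j → μ i * R zero j * x j) ⟩
      R (suc i) · x + (λ j → μ i * R zero j) · x                  ≈⟨ +-congˡ (·-*ˡ (μ i) (R zero) x) ⟨
      R (suc i) · x + μ i * (R zero · x)                          ∎

    ·-insertAt : ∀ (u : Vector Carrier (suc m)) x s → u · insertAt x k s ≈ u k * s + (u ∘ punchIn k) · x
    ·-insertAt u x s = begin
      u · insertAt x k s                                               ≈⟨ sum-remove {i = k} (λ j → u j * insertAt x k s j) ⟩
      u k * insertAt x k s k + sum (λ j → u (punchIn k j) * insertAt x k s (punchIn k j))
        ≡⟨ ≡.cong₂ (λ a b → u k * a + b) (insertAt-self x k s)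
                   (sum-cong-≗ (λ j → ≡.cong (u (punchIn k j) *_) (insertAt-punchIn x k s j))) ⟩
      u k * s + (u ∘ punchIn k) · x                                    ∎

    solvable-lift : Solvable reduced → Solvable R
    solvable-lift solve y = x , λ { zero → row₀ ; (suc i) → row i }
      where
      y′ : Vector Carrier p
      y′ i = y (suc i) + μ i * y zero
      x′ = proj₁ (solve y′)
      d = (R zero ∘ punchIn k) · x′
      x = insertAt x′ k ((y zero - d) * ι)

      row₀ : R zero · x ≈ y zero
      row₀ = begin
        R zero · x                                  ≈⟨ ·-insertAt (R zero) x′ _ ⟩
        R zero k * ((y zero - d) * ι) + d           ≈⟨ +-congʳ (pivot-cancel _) ⟩
        (y zero - d) + d                            ≈⟨ //-rightDividesˡ d (y zero) ⟩
        y zero                                      ∎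

      row : ∀ i → R (suc i) · x ≈ y (suc i)
      row i = +-cancelʳ (μ i * y zero) _ _ (begin
        R (suc i) · x + μ i * y zero                ≈⟨ +-congˡ (*-congˡ row₀) ⟨
        R (suc i) · x + μ i * (R zero · x)          ≈⟨ cleared-· i x ⟨
        cleared i · x                               ≈⟨ ·-insertAt (cleared i) x′ _ ⟩
        cleared i k * _ + reduced i · x′            ≈⟨ +-cong (trans (*-congʳ (cleared-pivot i)) (zeroˡ _)) (proj₂ (solve y′) i) ⟩
        0# + y′ i                                   ≈⟨ +-identityˡ (y′ i) ⟩
        y (suc i) + μ i * y zero                    ∎)

  pivot : ∀ {p m} (R : Matrix (suc p) m) → Independent R → ∃ λ k → ¬ R zero k ≈ 0#
  pivot R ind with any? (λ k → ¬? (R zero k ≈? 0#))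
  ... | yes found = found
  ... | no none = contradiction (sym (ind (1# V.∷ (λ _ → 0#)) row₀≈0 zero)) 0≉1
    where
    row₀≈0 : ∀ j → ((1# V.∷ (λ _ → 0#)) ⊙ R) j ≈ 0#
    row₀≈0 j = begin
      1# * R zero j + ((λ _ → 0#) ⊙ (R ∘ suc)) j ≈⟨ +-cong (*-identityˡ _) (⊙-zero (R ∘ suc) j) ⟩
      R zero j + 0#                              ≈⟨ +-identityʳ _ ⟩
      R zero j                                   ≈⟨ decidable-stable (R zero j ≈? 0#) (λ R₀ⱼ≉0 → none (j , R₀ⱼ≉0)) ⟩
      0#                                         ∎

  independent⇒≤×solvable : ∀ {p m} (R : Matrix p m) → Independent R → p ≤ m × Solvable R
  independent⇒≤×solvable {zero}          R ind = z≤n , λ y → (λ _ → 0#) , λ ()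
  independent⇒≤×solvable {suc p} {zero}  R ind with () ← proj₁ (pivot R ind)
  independent⇒≤×solvable {suc p} {suc m} R ind with pivot R ind
  ... | k , R₀ₖ≉0 = s≤s p≤m , solvable-lift solvable
    where
    open Pivot R k R₀ₖ≉0
    p≤m×solvable = independent⇒≤×solvable reduced (reduced-independent ind)
    p≤m = proj₁ p≤m×solvable
    solvable = proj₂ p≤m×solvable

  steinitz : ∀ {p q m} {U : Matrix p m} {G : Matrix q m} → Independent U → (∀ k → InRowSpace G (U k)) → p ≤ q
  steinitz {U = U} {G} ind U⊆G = proj₁ (independent⇒≤×solvable Λ Λ-independent)
    where
    Λ = λ k → proj₁ (U⊆G k)
    Λ-independent : Independent Λ
    Λ-independent c c⊙Λ≈0 = ind c λ j → begin
      (c ⊙ U) j                            ≈⟨ sum-cong (λ k → *-congˡ (proj₂ (U⊆G k) j)) ⟩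
      c · (λ k → Λ k · (λ i → G i j))      ≈⟨ ⊙-· c Λ (λ i → G i j) ⟨
      (c ⊙ Λ) · (λ i → G i j)              ≈⟨ ·-zeroˡ (λ i → G i j) c⊙Λ≈0 ⟩
      0#                                   ∎

module UpperSums {ℓ₁ ℓ₂} (K : CommutativeRing ℓ₁ ℓ₂) {n} (Ss : List (Subset n)) (Ss! : Unique Ss) where
  open CommutativeRing K
  open RingOps K
  open Sums K

  sum⊇ : (Subset n → Carrier) → Subset n → Carrier
  sum⊇ f X = sumL Ss (λ Y → when (X ⊆? Y) (f Y))

  sum⊇-cong : ∀ {f g} → (∀ {Y} → Y List.∈ Ss → f Y ≈ g Y) → ∀ X → sum⊇ f X ≈ sum⊇ g X
  sum⊇-cong f≈g X = sumL-cong Ss (λ {Y} Y∈ → when-cong (X ⊆? Y) (f≈g Y∈))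

  sum⊇-injective : ∀ f g → (∀ {X} → X List.∈ Ss → sum⊇ f X ≈ sum⊇ g X) → ∀ {X} → X List.∈ Ss → f X ≈ g X
  sum⊇-injective f g Σf≈Σg {X} = go X (⊃-wellFounded X)
    where
    go : ∀ X → Acc _⊃_ X → X List.∈ Ss → f X ≈ g X
    go X (acc above) X∈ = begin
      f X                   ≈⟨ when-yes (X ⊆? X) ⊆-refl ⟨
      when (X ⊆? X) (f X)   ≈⟨ sumL-agree-off Ss! X∈ _ _ agree (Σf≈Σg X∈) ⟩
      when (X ⊆? X) (g X)   ≈⟨ when-yes (X ⊆? X) ⊆-refl ⟩
      g X                   ∎
      where
      open import Relation.Binary.Reasoning.Setoid setoid
      agree : ∀ {Y} → Y List.∈ Ss → Y ≢ X → when (X ⊆? Y) (f Y) ≈ when (X ⊆? Y) (g Y)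
      agree {Y} Y∈ Y≢X with X ⊆? Y
      ... | yes X⊆Y = go Y (above (⊆∧≢⇒⊂ X⊆Y (Y≢X ∘ ≡.sym))) Y∈
      ... | no _    = refl

isZer≡true : ∀ {s} → isZer s ≡ true → s ≡ zer
isZer≡true {zer} _ = ≡.refl

∈-zeroSet⇔ : ∀ {n} (σ : Vec Sign n) i → i ∈ zeroSet σ ⇔ Vec.lookup σ i ≡ zer
∈-zeroSet⇔ σ i = mk⇔
  (λ i∈ → isZer≡true (≡.trans (≡.sym (lookup∘tabulate _ i)) ([]=⇒lookup i∈)))
  (λ σᵢ≡zer → lookup⇒[]= i (zeroSet σ) (≡.trans (lookup∘tabulate _ i) (≡.cong isZer σᵢ≡zer)))

module Geometry (ℝ : RealNumbers) {ℓ n : ℕ} (A : Arrangements.Arrangement ℝ ℓ n) where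
  open RawMonad (¬¬-Monad {a = 0ℓ})
  open RealNumbers ℝ hiding (zero)
  open Arrangements.Arrangement A
  open Sums realRing using (sumFin≡sum)
  open import Algebra.Properties.Semiring.Sum semiring using (sum; ∑-distrib-+)
  open import Relation.Binary.Reasoning.Setoid setoid
  module +-CS = Algebra.Properties.CommutativeSemigroup +-commutativeSemigroup
  module *-CS = Algebra.Properties.CommutativeSemigroup *-commutativeSemigroup

  _≈?_ : Decidable _≈_
  x ≈? y with trichotomy x y
  ... | inj₁ x<y        = no (λ x≈y → <-irrefl (<-resp-≈ x≈y refl x<y))
  ... | inj₂ (inj₁ x≈y) = yes x≈y
  ... | inj₂ (inj₂ y<x) = no (λ x≈y → <-irrefl (<-resp-≈ refl x≈y y<x))

  open LinearAlgebra realRing isField _≈?_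

  signOf-zero : ∀ {s r} → SignOf s r → r ≈ 0# → s ≡ zer
  signOf-zero {neg} r<0 r≈0 = contradiction (<-resp-≈ r≈0 refl r<0) <-irrefl
  signOf-zero {zer} _   _   = ≡.refl
  signOf-zero {pos} 0<r r≈0 = contradiction (<-resp-≈ refl r≈0 0<r) <-irrefl

  zeroSet-isFlat : ∀ {σ} → IsFace σ → IsFlat (zeroSet σ)
  zeroSet-isFlat {σ} (x , signs) = (x , x∈⋂) , closed
    where
    x∈⋂ : InInter (zeroSet σ) x
    x∈⋂ i i∈ = ≡.subst (λ s → SignOf s (val i x)) (Equivalence.to (∈-zeroSet⇔ σ i) i∈) (signs i)
    closed : ∀ j → (∀ y → InInter (zeroSet σ) y → val j y ≈ 0#) → j ∈ zeroSet σ
    closed j vanishes = Equivalence.from (∈-zeroSet⇔ σ j) (signOf-zero (signs j) (vanishes x x∈⋂))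

  val≡ : ∀ i x → val i x ≡ a i · x - b i
  val≡ i x = ≡.cong (_- b i) (sumFin≡sum (λ q → a i q * x q))

  val-translate : ∀ i x s y → val i (λ q → x q + s * y q) ≈ val i x + s * (a i · y)
  val-translate i x s y = begin
    val i (λ q → x q + s * y q)                         ≡⟨ val≡ i (λ q → x q + s * y q) ⟩
    sum (λ q → a i q * (x q + s * y q)) - b i           ≈⟨ +-congʳ (sum-cong (λ q → distribˡ (a i q) (x q) (s * y q))) ⟩
    sum (λ q → a i q * x q + a i q * (s * y q)) - b i   ≈⟨ +-congʳ (sum-cong (λ q → +-congˡ (*-CS.x∙yz≈yx∙z (a i q) s (y q)))) ⟩
    sum (λ q → a i q * x q + s * a i q * y q) - b i     ≈⟨ +-congʳ (∑-distrib-+ (λ q → a i q * x q) (λ q → s * a i q * y q)) ⟩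
    (a i · x + (λ q → s * a i q) · y) - b i             ≈⟨ +-congʳ (+-congˡ (·-*ˡ s (a i) y)) ⟨
    (a i · x + s * (a i · y)) - b i                     ≈⟨ +-CS.xy∙z≈xz∙y (a i · x) _ _ ⟩
    (a i · x - b i) + s * (a i · y)                     ≡⟨ ≡.cong (_+ s * (a i · y)) (val≡ i x) ⟨
    val i x + s * (a i · y)                             ∎

  linIndep⇒independent : ∀ {vs} → LinIndep vs → Independent (List.lookup vs)
  linIndep⇒independent {vs} ind c c⊙vs≈0 =
    ind c (λ j → trans (reflexive (sumFin≡sum (λ k → c k * List.lookup vs k j))) (c⊙vs≈0 j))

  independent⇒linIndep : ∀ {vs} → Independent (List.lookup vs) → LinIndep vs
  independent⇒linIndep {vs} ind c c⊙vs≈0 =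
    ind c (λ j → trans (reflexive (≡.sym (sumFin≡sum (λ k → c k * List.lookup vs k j)))) (c⊙vs≈0 j))

  normal∈normalsOf : ∀ {S i} → i ∈ S → a i List.∈ normalsOf S
  normal∈normalsOf {i = i} i∈S = ∈-map⁺ a (∈-filter⁺ _ (∈-allFin i) ([]=⇒lookup i∈S))

  ∈normalsOf⇒normal : ∀ {S v} → v List.∈ normalsOf S → ∃ λ i → v ≡ a i
  ∈normalsOf⇒normal v∈ = let i , _ , v≡aᵢ = ∈-map⁻ a v∈ in i , v≡aᵢ

  flat-meets-hyperplane : ∀ {M x₀ gs j} → InInter M x₀ → Independent (List.lookup gs) →
    (∀ {v} → v List.∈ normalsOf M → InRowSpace (List.lookup gs) v) → ¬ InRowSpace (List.lookup gs) (a j) →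
    ∃ λ z → InInter M z × val j z ≈ 0#
  flat-meets-hyperplane {M} {x₀} {gs} {j} x₀∈⋂M ind span aⱼ∉span = z , z∈⋂M , z∈Hⱼ
    where
    solution = proj₂ (independent⇒≤×solvable (a j V.∷ List.lookup gs) (independent-∷ ind aⱼ∉span)) (1# V.∷ λ _ → 0#)
    y = proj₁ solution
    s = - val j x₀
    z = λ q → x₀ q + s * y q
    z∈Hⱼ : val j z ≈ 0#
    z∈Hⱼ = begin
      val j z                        ≈⟨ val-translate j x₀ s y ⟩
      val j x₀ + s * (a j · y)       ≈⟨ +-congˡ (trans (*-congˡ (proj₂ solution zero)) (*-identityʳ s)) ⟩
      val j x₀ - val j x₀            ≈⟨ -‿inverseʳ (val j x₀) ⟩
      0#                             ∎
    z∈⋂M : InInter M z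
    z∈⋂M i i∈M = begin
      val i z                        ≈⟨ val-translate i x₀ s y ⟩
      val i x₀ + s * (a i · y)       ≈⟨ +-cong (x₀∈⋂M i i∈M) (*-congˡ aᵢ⊥y) ⟩
      0# + s * 0#                    ≈⟨ trans (+-identityˡ _) (zeroʳ s) ⟩
      0#                             ∎
      where
      aᵢ⊥y = rowSpace-⊥ y (span (normal∈normalsOf i∈M)) (proj₂ solution ∘ suc)

  minimalFlat-avoids : ∀ {M j z} → MinimalFlat M → j ∉ M → InInter M z → ¬ val j z ≈ 0#
  -- Y is the set of hyperplanes containing M ∩ Hⱼ; it is a flat strictly below M.
  minimalFlat-avoids {M} {j} {z} (_ , minimal) j∉M z∈⋂M z∈Hⱼ = ¬¬-comprehension VanishesOnSlice λ (Y , Y⇔) →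
    j∉M (≡.subst (j ∈_) (minimal Y (isFlat Y⇔) (M⊆Y Y⇔)) (Equivalence.from (Y⇔ j) (λ _ _ vⱼ → vⱼ)))
    where
    VanishesOnSlice : Fin n → Set
    VanishesOnSlice i = ∀ x → InInter M x → val j x ≈ 0# → val i x ≈ 0#
    module _ {Y} (Y⇔ : ∀ i → i ∈ Y ⇔ VanishesOnSlice i) where
      slice⊆⋂Y : ∀ x → InInter M x → val j x ≈ 0# → InInter Y x
      slice⊆⋂Y x x∈⋂M vⱼ i i∈Y = Equivalence.to (Y⇔ i) i∈Y x x∈⋂M vⱼ
      isFlat : IsFlat Y
      isFlat = (z , slice⊆⋂Y z z∈⋂M z∈Hⱼ) ,
        λ i vanishes → Equivalence.from (Y⇔ i) (λ x x∈⋂M vⱼ → vanishes x (slice⊆⋂Y x x∈⋂M vⱼ))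
      M⊆Y : M ⊆ₛ Y
      M⊆Y {i} i∈M = Equivalence.from (Y⇔ i) (λ x x∈⋂M _ → x∈⋂M i i∈M)

  minimalFlat-normals-span : ∀ {M gs} → MinimalFlat M → Independent (List.lookup gs) →
    (∀ {v} → v List.∈ normalsOf M → InRowSpace (List.lookup gs) v) → ∀ j → ¬ ¬ InRowSpace (List.lookup gs) (a j)
  minimalFlat-normals-span {gs = gs} mM@(((x₀ , x₀∈⋂M) , _) , _) ind span j aⱼ∉span =
    let z , z∈⋂M , z∈Hⱼ = flat-meets-hyperplane {gs = gs} x₀∈⋂M ind span aⱼ∉span
    in  minimalFlat-avoids mM (aⱼ∉span ∘ span ∘ normal∈normalsOf) z∈⋂M z∈Hⱼ

  minimalFlat-rank-maximal : ∀ {M S r r′} → MinimalFlat M → HasRank (normalsOf M) r → HasRank (normalsOf S) r′ → r′ ≤ r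
  -- The goal is decidable, so the basis and the span memberships may be obtained classically.
  minimalFlat-rank-maximal {M} {S} {r} {r′} mM (_ , maximal) ((us , us⊆ , us-ind , ∣us∣≡r′) , _) =
    decidable-stable (r′ ≤? r) do
      gs , gs⊆ , gs-ind , gs-span ← ¬¬-basis (normalsOf M)
      us⊆span ← ¬¬-∀ (λ k →
        let i , uₖ≡aᵢ = ∈normalsOf⇒normal {S} (Sublist.lookup us⊆ (∈-lookup k))
        in  ≡.subst (InRowSpace (List.lookup gs)) (≡.sym uₖ≡aᵢ) <$> minimalFlat-normals-span {gs = gs} mM gs-ind gs-span i)
      pure (≡.subst (_≤ r) ∣us∣≡r′
        (≤-trans (steinitz (linIndep⇒independent {us} us-ind) us⊆span) (maximal gs gs⊆ (independent⇒linIndep {gs} gs-ind))))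

  hasRank-unique : ∀ {vs r r′} → HasRank vs r → HasRank vs r′ → r ≡ r′
  hasRank-unique ((us , us⊆ , us-ind , ∣us∣≡r) , maximal) ((us′ , us′⊆ , us′-ind , ∣us′∣≡r′) , maximal′) =
    ≤-antisym (≡.subst (_≤ _) ∣us∣≡r (maximal′ us us⊆ us-ind))
              (≡.subst (_≤ _) ∣us′∣≡r′ (maximal us′ us′⊆ us′-ind))

  dim-unique : ∀ {S d d′} → Dim S d → Dim S d′ → d ≡ d′
  dim-unique {d = d} {d′} (r , hr , d+r≡ℓ) (r′ , hr′ , d′+r′≡ℓ) with hasRank-unique hr hr′
  ... | ≡.refl = +-cancelʳ-≡ r d d′ (≡.trans d+r≡ℓ (≡.sym d′+r′≡ℓ))

  minimalFlat-dim-unique : ∀ {M M′ d d′} → MinimalFlat M → MinimalFlat M′ → Dim M d → Dim M′ d′ → d ≡ d′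
  minimalFlat-dim-unique {M} {M′} {d} {d′} mM mM′ (r , hr , d+r≡ℓ) (r′ , hr′ , d′+r′≡ℓ)
    with ≤-antisym (minimalFlat-rank-maximal {S = M} mM′ hr′ hr) (minimalFlat-rank-maximal {S = M′} mM hr hr′)
  ... | ≡.refl = +-cancelʳ-≡ r d d′ (≡.trans d+r≡ℓ (≡.sym d′+r′≡ℓ))

  rankFlat-unique : ∀ {X r r′} → RankFlat X r → RankFlat X r′ → r ≡ r′
  rankFlat-unique {X} {r} {r′} (dX , d , M , DX , mM , DM , r+d≡dX) (dX′ , d′ , M′ , DX′ , mM′ , DM′ , r′+d′≡dX′)
    with dim-unique {X} DX DX′ | minimalFlat-dim-unique mM mM′ DM DM′
  ... | ≡.refl | ≡.refl = +-cancelʳ-≡ d r r′ (≡.trans r+d≡dX (≡.sym r′+d′≡dX′))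

module CharacteristicElements (ℝ : RealNumbers) {ℓ n : ℕ} (A : Arrangements.Arrangement ℝ ℓ n)
                              (E : Arrangements.Enumeration ℝ A) {c ℓ′ : Level} (K : CommutativeRing c ℓ′) where
  open TitsNotions ℝ A E K
  open Arrangements.Enumeration E
  open CommutativeRing K
  open RingOps K
  open Sums K
  open UpperSums K flats flats-uniq
  open Geometry ℝ A using (zeroSet-isFlat; rankFlat-unique)
  open import Relation.Binary.Reasoning.Setoid setoid

  χ≈sum⊇χ= : ∀ w X → χ w X ≈ sum⊇ (χ= w) X
  χ≈sum⊇χ= w X = sym (begin
    sumL flats (λ Y → when (X ⊆? Y) (sumL faces (λ σ → when (zeroSet σ ≟ₛ Y) (w σ))))
      ≈⟨ sumL-cong flats (λ {Y} _ → when-sumL (X ⊆? Y) faces _) ⟩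
    sumL flats (λ Y → sumL faces (λ σ → when (X ⊆? Y) (when (zeroSet σ ≟ₛ Y) (w σ))))
      ≈⟨ sumL-comm flats faces _ ⟩
    sumL faces (λ σ → sumL flats (λ Y → when (X ⊆? Y) (when (zeroSet σ ≟ₛ Y) (w σ))))
      ≈⟨ sumL-cong faces support-term ⟩
    χ w X ∎)
    where
    support-term : ∀ {σ} → σ List.∈ faces →
      sumL flats (λ Y → when (X ⊆? Y) (when (zeroSet σ ≟ₛ Y) (w σ))) ≈ when (X ⊆? zeroSet σ) (w σ)
    support-term {σ} σ∈ = trans
      (sumL-single flats-uniq (proj₁ (flats-spec _) (zeroSet-isFlat {σ} (proj₂ (faces-spec σ) σ∈))) _
        (λ {Y} _ Y≢ → trans (when-cong (X ⊆? Y) (when-no (zeroSet σ ≟ₛ Y) (Y≢ ∘ ≡.sym))) (when-zero (X ⊆? Y))))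
      (when-cong (X ⊆? zeroSet σ) (when-yes (zeroSet σ ≟ₛ zeroSet σ) ≡.refl))

  module _ {μ : Subset n → Subset n → Carrier} (isMöbius : IsMobius μ) where

    interval-sum : ∀ {X Z} → IsFlat X → Z List.∈ flats →
      sumL flats (λ Y → when (X ⊆? Y) (when (Y ⊆? Z) (μ Z Y))) ≈ when (Z ≟ₛ X) 1#
    interval-sum {X} {Z} fX Z∈ with X ⊆? Z
    ... | yes X⊆Z = isMöbius Z X (proj₂ (flats-spec Z) Z∈) fX X⊆Z
    ... | no X⊈Z  = trans (sumL-zero flats empty) (sym (when-no (Z ≟ₛ X) (λ { ≡.refl → X⊈Z (λ i∈X → i∈X) })))
      where
      empty : ∀ {Y} → Y List.∈ flats → when (X ⊆? Y) (when (Y ⊆? Z) (μ Z Y)) ≈ 0#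
      empty {Y} _ with X ⊆? Y | Y ⊆? Z
      ... | yes X⊆Y | yes Y⊆Z = contradiction (λ {i} → ⊆-trans X⊆Y Y⊆Z {i}) X⊈Z
      ... | yes _   | no _    = refl
      ... | no _    | _       = refl

    sum⊇-möbius : ∀ (φ : Subset n → Carrier) {X} → IsFlat X →
      sum⊇ (λ Y → sumL flats (λ Z → when (Y ⊆? Z) (μ Z Y * φ Z))) X ≈ φ X
    sum⊇-möbius φ {X} fX = begin
      sumL flats (λ Y → when (X ⊆? Y) (sumL flats (λ Z → when (Y ⊆? Z) (μ Z Y * φ Z))))
        ≈⟨ sumL-cong flats (λ {Y} _ → when-sumL (X ⊆? Y) flats _) ⟩
      sumL flats (λ Y → sumL flats (λ Z → when (X ⊆? Y) (when (Y ⊆? Z) (μ Z Y * φ Z))))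
        ≈⟨ sumL-comm flats flats _ ⟩
      sumL flats (λ Z → sumL flats (λ Y → when (X ⊆? Y) (when (Y ⊆? Z) (μ Z Y * φ Z))))
        ≈⟨ sumL-cong flats (λ {Z} _ → trans (sumL-cong flats (λ {Y} _ →
             trans (when-cong (X ⊆? Y) (when-*ʳ (Y ⊆? Z) (μ Z Y) (φ Z))) (when-*ʳ (X ⊆? Y) _ (φ Z))))
             (sumL-*ʳ flats _ (φ Z))) ⟩
      sumL flats (λ Z → sumL flats (λ Y → when (X ⊆? Y) (when (Y ⊆? Z) (μ Z Y))) * φ Z)
        ≈⟨ sumL-cong flats (λ Z∈ → *-congʳ (interval-sum fX Z∈)) ⟩
      sumL flats (λ Z → when (Z ≟ₛ X) 1# * φ Z)
        ≈⟨ sumL-single flats-uniq (proj₁ (flats-spec X) fX) _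
             (λ {Z} _ Z≢X → trans (*-congʳ (when-no (Z ≟ₛ X) Z≢X)) (zeroˡ (φ Z))) ⟩
      when (X ≟ₛ X) 1# * φ X
        ≈⟨ trans (*-congʳ (when-yes (X ≟ₛ X) ≡.refl)) (*-identityˡ (φ X)) ⟩
      φ X ∎

    module _ {rk : Subset n → ℕ} (rk-spec : ∀ X → IsFlat X → RankFlat X (rk X)) (t : Carrier) (w : TitsElem) where

      sum⊇-charPoly : ∀ {X} → IsFlat X → sum⊇ (λ Y → charPoly μ rk Y t) X ≈ pow t (rk X)
      sum⊇-charPoly = sum⊇-möbius (λ Z → pow t (rk Z))

      characteristic⇒χ=≈charPoly : IsCharacteristic w t → ∀ X → IsFlat X → χ= w X ≈ charPoly μ rk X t
      characteristic⇒χ=≈charPoly char X fX =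
        sum⊇-injective (χ= w) (λ Y → charPoly μ rk Y t) sums≈ (proj₁ (flats-spec X) fX)
        where
        sums≈ : ∀ {Y} → Y List.∈ flats → sum⊇ (χ= w) Y ≈ sum⊇ (λ Y → charPoly μ rk Y t) Y
        sums≈ {Y} Y∈ = let fY = proj₂ (flats-spec Y) Y∈ in begin
          sum⊇ (χ= w) Y                       ≈⟨ χ≈sum⊇χ= w Y ⟨
          χ w Y                               ≈⟨ char Y fY (rk Y) (rk-spec Y fY) ⟩
          pow t (rk Y)                        ≈⟨ sum⊇-charPoly fY ⟨
          sum⊇ (λ Y → charPoly μ rk Y t) Y    ∎

      χ=≈charPoly⇒characteristic : (∀ X → IsFlat X → χ= w X ≈ charPoly μ rk X t) → IsCharacteristic w t
      χ=≈charPoly⇒characteristic χ=≈ X fX r rankX = begin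
        χ w X                               ≈⟨ χ≈sum⊇χ= w X ⟩
        sum⊇ (χ= w) X                       ≈⟨ sum⊇-cong (λ {Y} Y∈ → χ=≈ Y (proj₂ (flats-spec Y) Y∈)) X ⟩
        sum⊇ (λ Y → charPoly μ rk Y t) X    ≈⟨ sum⊇-charPoly fX ⟩
        pow t (rk X)                        ≡⟨ ≡.cong (pow t) (rankFlat-unique {X} (rk-spec X fX) rankX) ⟩
        pow t r                             ∎

lemma2p2 : (ℝ : RealNumbers) {ℓ n : ℕ} (A : Arrangements.Arrangement ℝ ℓ n)
    (E : Arrangements.Enumeration ℝ A)
    {c ℓ′ : Level} (K : CommutativeRing c ℓ′) → IsField K →
    (μ : Subset n → Subset n → CommutativeRing.Carrier K) →
    TitsNotions.IsMobius ℝ A E K μ →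
    (rk : Subset n → ℕ) →
    (∀ X → TitsNotions.IsFlat ℝ A E K X → TitsNotions.RankFlat ℝ A E K X (rk X)) →
    (t : CommutativeRing.Carrier K) (w : TitsNotions.TitsElem ℝ A E K) →
    TitsNotions.IsCharacteristic ℝ A E K w t ⇔
      (∀ X → TitsNotions.IsFlat ℝ A E K X →
        CommutativeRing._≈_ K (TitsNotions.χ= ℝ A E K w X) (TitsNotions.charPoly ℝ A E K μ rk X t))
lemma2p2 ℝ A E K _ μ isMöbius rk rk-spec t w =
  mk⇔ (characteristic⇒χ=≈charPoly isMöbius rk-spec t w) (χ=≈charPoly⇒characteristic isMöbius rk-spec t w)
  where open CharacteristicElements ℝ A E K
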